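{- Let $R$ be a commutative ring with $1$, and let $\{u_n(q)\}_{n=1}^\infty$ and $\{v_m(q)\}_{m=1}^\infty$ be sequences of polynomials in $R[q]$. Then $[m+n]_q = u_n(q)[m]_q + v_m(q)[n]_q$ for all positive integers $m,n$ if and only if there exists a polynomial $z(q)\in R[q]$ such that $u_n(q)=1+z(q)[n]_q$ and $v_m(q)=q^m - z(q)[m]_q$ for all positive integers $m,n$. Moreover, in that case $z(q)=u_1(q)-1=q-v_1(q)$.
   Context: For a positive integer $n$, the quantum integer $[n]_q$ is the polynomial $1+q+q^2+\cdots+q^{n-1}$. -}

module Defs where

open import Level using (_⊔_)
open import Data.Nat using (ℕ; zero; suc)
open import Data.List using (List; []; _∷_)
open import Algebra.Bundles using (CommutativeRing)

-- The univariate polynomial ring R[q] over a commutative ring R with 1.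
-- A polynomial is a finite list of coefficients [a₀, a₁, …] (constant term first);
-- two polynomials are equal iff all their coefficients agree (trailing zeros ignored),
-- with coefficient equality being the ring's setoid equality.
module Poly {c ℓ} (R : CommutativeRing c ℓ) where
  open CommutativeRing R renaming (Carrier to A)

  Pol : Set c
  Pol = List A

  coeff : Pol → ℕ → A
  coeff []      _       = 0#
  coeff (a ∷ p) zero    = a
  coeff (a ∷ p) (suc i) = coeff p i

  infix 4 _≈ₚ_
  _≈ₚ_ : Pol → Pol → Set ℓ
  p ≈ₚ r = ∀ i → coeff p i ≈ coeff r i

  infixl 6 _+ₚ_ _-ₚ_
  infixl 7 _*ₚ_ _·ₚ_
  infixr 8 _^ₚ_

  _+ₚ_ : Pol → Pol → Pol
  []      +ₚ r       = r
  (a ∷ p) +ₚ []      = a ∷ p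
  (a ∷ p) +ₚ (b ∷ r) = (a + b) ∷ (p +ₚ r)

  -ₚ_ : Pol → Pol
  -ₚ []      = []
  -ₚ (a ∷ p) = (- a) ∷ (-ₚ p)

  _-ₚ_ : Pol → Pol → Pol
  p -ₚ r = p +ₚ (-ₚ r)

  _·ₚ_ : A → Pol → Pol
  a ·ₚ []      = []
  a ·ₚ (b ∷ p) = (a * b) ∷ (a ·ₚ p)

  _*ₚ_ : Pol → Pol → Pol
  []      *ₚ r = []
  (a ∷ p) *ₚ r = (a ·ₚ r) +ₚ (0# ∷ (p *ₚ r))

  1ₚ : Pol
  1ₚ = 1# ∷ []

  qₚ : Pol
  qₚ = 0# ∷ 1# ∷ []

  _^ₚ_ : Pol → ℕ → Pol
  p ^ₚ zero  = 1ₚ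
  p ^ₚ suc n = p *ₚ (p ^ₚ n)

  [_]q : ℕ → Pol
  [ zero ]q  = []
  [ suc n ]q = [ n ]q +ₚ (qₚ ^ₚ n)

-- Taking m = 1, respectively n = 1, in the splitting and comparing with
-- [m + n]_q = [m]_q + q^m [n]_q and [1]_q = 1 determines u n and v m:
-- u n = 1 + z [n]_q and v m = q^m - z [m]_q, where u 1 + v 1 = [2]_q = 1 + q
-- gives z = u 1 - 1 = q - v 1.  Conversely, for every z,
-- (1 + z [n]_q) [m]_q + (q^m - z [m]_q) [n]_q = [m]_q + q^m [n]_q = [m + n]_q.
module Submission where

open import Algebra.Bundles using (CommutativeRing)
open import Algebra.Structures using (IsCommutativeRing)
open import Data.List using ([]; _∷_)
open import Data.Nat as ℕ using (ℕ; zero; suc; _≤_; s≤s; z≤n)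
import Data.Nat.Properties as ℕₚ
open import Data.Product using (_×_; ∃; _,_)
open import Function.Bundles using (_⇔_; mk⇔)
open import Relation.Binary.Bundles using (Setoid)
open import Relation.Binary.PropositionalEquality using (cong)
open import Relation.Binary.Structures using (IsEquivalence)
open import Defs

module PolynomialRing {c ℓ} (R : CommutativeRing c ℓ) where
  open CommutativeRing R renaming (Carrier to A) hiding (zero)
  open import Algebra.Properties.AbelianGroup +-abelianGroup using (ε⁻¹≈ε)
  open import Algebra.Properties.CommutativeSemigroup +-commutativeSemigroup
    using (interchange; x∙yz≈y∙xz)
  open Poly R

  coeff-+ₚ : ∀ p r i → coeff (p +ₚ r) i ≈ coeff p i + coeff r i
  coeff-+ₚ []      r       i       = sym (+-identityˡ _)
  coeff-+ₚ (a ∷ p) []      i       = sym (+-identityʳ _)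
  coeff-+ₚ (a ∷ p) (b ∷ r) zero    = refl
  coeff-+ₚ (a ∷ p) (b ∷ r) (suc i) = coeff-+ₚ p r i

  coeff--ₚ : ∀ p i → coeff (-ₚ p) i ≈ - coeff p i
  coeff--ₚ []      i       = sym ε⁻¹≈ε
  coeff--ₚ (a ∷ p) zero    = refl
  coeff--ₚ (a ∷ p) (suc i) = coeff--ₚ p i

  coeff-·ₚ : ∀ a p i → coeff (a ·ₚ p) i ≈ a * coeff p i
  coeff-·ₚ a []      i       = sym (zeroʳ a)
  coeff-·ₚ a (b ∷ p) zero    = refl
  coeff-·ₚ a (b ∷ p) (suc i) = coeff-·ₚ a p i

  -- Unlike the function type p ≈ₚ r, this record type determines p and r,
  -- so Agda can infer them when they are implicit.
  infix 4 _≋_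
  record _≋_ (p r : Pol) : Set ℓ where
    constructor ≈ₚ⇒≋
    field ≋⇒≈ₚ : p ≈ₚ r
  open _≋_

  ≋-isEquivalence : IsEquivalence _≋_
  ≋-isEquivalence = record
    { refl  = ≈ₚ⇒≋ λ i → refl
    ; sym   = λ (≈ₚ⇒≋ e) → ≈ₚ⇒≋ λ i → sym (e i)
    ; trans = λ (≈ₚ⇒≋ e) (≈ₚ⇒≋ f) → ≈ₚ⇒≋ λ i → trans (e i) (f i)
    }

  ≋-setoid : Setoid c ℓ
  ≋-setoid = record { isEquivalence = ≋-isEquivalence }

  open IsEquivalence ≋-isEquivalence renaming (refl to ≋-refl; sym to ≋-sym; trans to ≋-trans)
  open import Algebra.Definitions _≋_
  open import Relation.Binary.Reasoning.Setoid ≋-setoid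

  coeffwise : ∀ {p r} {f g : ℕ → A} →
    (∀ i → coeff p i ≈ f i) → (∀ i → f i ≈ g i) → (∀ i → coeff r i ≈ g i) → p ≋ r
  coeffwise p≈f f≈g r≈g = ≈ₚ⇒≋ λ i → trans (p≈f i) (trans (f≈g i) (sym (r≈g i)))

  ∷-cong : ∀ {a b p r} → a ≈ b → p ≋ r → (a ∷ p) ≋ (b ∷ r)
  ∷-cong a≈b (≈ₚ⇒≋ p≈r) = ≈ₚ⇒≋ λ { zero → a≈b ; (suc i) → p≈r i }

  0∷[]≋[] : (0# ∷ []) ≋ []
  0∷[]≋[] = ≈ₚ⇒≋ λ { zero → refl ; (suc i) → refl }

  +ₚ-cong : Congruent₂ _+ₚ_
  +ₚ-cong {p} {p′} {r} {r′} (≈ₚ⇒≋ e) (≈ₚ⇒≋ f) =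
    coeffwise (coeff-+ₚ p r) (λ i → +-cong (e i) (f i)) (coeff-+ₚ p′ r′)

  coeff-+ₚ-+ₚˡ : ∀ p r s i → coeff ((p +ₚ r) +ₚ s) i ≈ (coeff p i + coeff r i) + coeff s i
  coeff-+ₚ-+ₚˡ p r s i = trans (coeff-+ₚ (p +ₚ r) s i) (+-congʳ (coeff-+ₚ p r i))

  coeff-+ₚ-+ₚʳ : ∀ p r s i → coeff (p +ₚ (r +ₚ s)) i ≈ coeff p i + (coeff r i + coeff s i)
  coeff-+ₚ-+ₚʳ p r s i = trans (coeff-+ₚ p (r +ₚ s) i) (+-congˡ (coeff-+ₚ r s i))

  +ₚ-assoc : Associative _+ₚ_
  +ₚ-assoc p r s = coeffwise (coeff-+ₚ-+ₚˡ p r s) (λ _ → +-assoc _ _ _) (coeff-+ₚ-+ₚʳ p r s)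

  +ₚ-leftComm : ∀ p r s → p +ₚ (r +ₚ s) ≋ r +ₚ (p +ₚ s)
  +ₚ-leftComm p r s = coeffwise (coeff-+ₚ-+ₚʳ p r s) (λ _ → x∙yz≈y∙xz _ _ _) (coeff-+ₚ-+ₚʳ r p s)

  +ₚ-comm : Commutative _+ₚ_
  +ₚ-comm p r = coeffwise (coeff-+ₚ p r) (λ _ → +-comm _ _) (coeff-+ₚ r p)

  +ₚ-interchange : ∀ p r s t → (p +ₚ r) +ₚ (s +ₚ t) ≋ (p +ₚ s) +ₚ (r +ₚ t)
  +ₚ-interchange p r s t = coeffwise (coeff-+ₚ₄ p r s t) (λ _ → interchange _ _ _ _) (coeff-+ₚ₄ p s r t)
    where
    coeff-+ₚ₄ : ∀ p r s t i →
      coeff ((p +ₚ r) +ₚ (s +ₚ t)) i ≈ (coeff p i + coeff r i) + (coeff s i + coeff t i)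
    coeff-+ₚ₄ p r s t i =
      trans (coeff-+ₚ (p +ₚ r) (s +ₚ t) i) (+-cong (coeff-+ₚ p r i) (coeff-+ₚ s t i))

  +ₚ-identityʳ : RightIdentity [] _+ₚ_
  +ₚ-identityʳ p = coeffwise (coeff-+ₚ p []) (λ _ → +-identityʳ _) (λ _ → refl)

  -ₚ-cong : Congruent₁ (-ₚ_)
  -ₚ-cong {p} {p′} (≈ₚ⇒≋ e) = coeffwise (coeff--ₚ p) (λ i → -‿cong (e i)) (coeff--ₚ p′)

  -ₚ-inverseˡ : LeftInverse [] (-ₚ_) _+ₚ_
  -ₚ-inverseˡ p = coeffwise
    (λ i → trans (coeff-+ₚ (-ₚ p) p i) (+-congʳ (coeff--ₚ p i))) (λ _ → -‿inverseˡ _) (λ _ → refl)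

  -ₚ-inverseʳ : RightInverse [] (-ₚ_) _+ₚ_
  -ₚ-inverseʳ p = ≋-trans (+ₚ-comm p (-ₚ p)) (-ₚ-inverseˡ p)

  ·ₚ-cong : ∀ {a b p r} → a ≈ b → p ≋ r → a ·ₚ p ≋ b ·ₚ r
  ·ₚ-cong {a} {b} {p} {r} a≈b (≈ₚ⇒≋ e) =
    coeffwise (coeff-·ₚ a p) (λ i → *-cong a≈b (e i)) (coeff-·ₚ b r)

  ·ₚ-distrib-+ₚ : ∀ a p r → a ·ₚ (p +ₚ r) ≋ a ·ₚ p +ₚ a ·ₚ r
  ·ₚ-distrib-+ₚ a p r = coeffwise
    (λ i → trans (coeff-·ₚ a (p +ₚ r) i) (*-congˡ (coeff-+ₚ p r i)))
    (λ _ → distribˡ _ _ _)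
    (λ i → trans (coeff-+ₚ (a ·ₚ p) (a ·ₚ r) i) (+-cong (coeff-·ₚ a p i) (coeff-·ₚ a r i)))

  *-·ₚ : ∀ a b p → (a * b) ·ₚ p ≋ a ·ₚ (b ·ₚ p)
  *-·ₚ a b p = coeffwise (coeff-·ₚ (a * b) p) (λ _ → *-assoc _ _ _)
    (λ i → trans (coeff-·ₚ a (b ·ₚ p) i) (*-congˡ (coeff-·ₚ b p i)))

  0#·ₚ : ∀ p → 0# ·ₚ p ≋ []
  0#·ₚ p = coeffwise (coeff-·ₚ 0# p) (λ _ → zeroˡ _) (λ _ → refl)

  1#·ₚ : ∀ p → 1# ·ₚ p ≋ p
  1#·ₚ p = coeffwise (coeff-·ₚ 1# p) (λ _ → *-identityˡ _) (λ _ → refl)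

  *ₚ-congˡ : LeftCongruent _*ₚ_
  *ₚ-congˡ {[]}    r≋r′ = ≋-refl
  *ₚ-congˡ {a ∷ p} r≋r′ = +ₚ-cong (·ₚ-cong refl r≋r′) (∷-cong refl (*ₚ-congˡ {p} r≋r′))

  *ₚ-zeroʳ : RightZero [] _*ₚ_
  *ₚ-zeroʳ []      = ≋-refl
  *ₚ-zeroʳ (a ∷ p) = ≋-trans (∷-cong refl (*ₚ-zeroʳ p)) 0∷[]≋[]

  *ₚ-∷ʳ : ∀ p b r → p *ₚ (b ∷ r) ≋ b ·ₚ p +ₚ (0# ∷ (p *ₚ r))
  *ₚ-∷ʳ []      b r = ≋-sym 0∷[]≋[]
  *ₚ-∷ʳ (a ∷ p) b r = ∷-cong (+-congʳ (*-comm a b)) (begin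
    a ·ₚ r +ₚ p *ₚ (b ∷ r)                ≈⟨ +ₚ-cong ≋-refl (*ₚ-∷ʳ p b r) ⟩
    a ·ₚ r +ₚ (b ·ₚ p +ₚ (0# ∷ (p *ₚ r))) ≈⟨ +ₚ-leftComm (a ·ₚ r) (b ·ₚ p) _ ⟩
    b ·ₚ p +ₚ (a ·ₚ r +ₚ (0# ∷ (p *ₚ r))) ∎)

  *ₚ-comm : Commutative _*ₚ_
  *ₚ-comm []      r = ≋-sym (*ₚ-zeroʳ r)
  *ₚ-comm (a ∷ p) r = ≋-trans (+ₚ-cong ≋-refl (∷-cong refl (*ₚ-comm p r))) (≋-sym (*ₚ-∷ʳ r a p))

  *ₚ-congʳ : RightCongruent _*ₚ_
  *ₚ-congʳ {r} {p} {p′} p≋p′ = ≋-trans (*ₚ-comm p r) (≋-trans (*ₚ-congˡ {r} p≋p′) (*ₚ-comm r p′))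

  *ₚ-cong : Congruent₂ _*ₚ_
  *ₚ-cong {p} {p′} {r} p≋p′ r≋r′ = ≋-trans (*ₚ-congʳ {r} p≋p′) (*ₚ-congˡ {p′} r≋r′)

  *ₚ-distribˡ : _*ₚ_ DistributesOverˡ _+ₚ_
  *ₚ-distribˡ []      r s = ≋-refl
  *ₚ-distribˡ (a ∷ p) r s = begin
    a ·ₚ (r +ₚ s) +ₚ (0# ∷ (p *ₚ (r +ₚ s)))
      ≈⟨ +ₚ-cong (·ₚ-distrib-+ₚ a r s) (∷-cong (sym (+-identityʳ 0#)) (*ₚ-distribˡ p r s)) ⟩
    (a ·ₚ r +ₚ a ·ₚ s) +ₚ ((0# ∷ (p *ₚ r)) +ₚ (0# ∷ (p *ₚ s)))
      ≈⟨ +ₚ-interchange (a ·ₚ r) (a ·ₚ s) _ _ ⟩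
    (a ·ₚ r +ₚ (0# ∷ (p *ₚ r))) +ₚ (a ·ₚ s +ₚ (0# ∷ (p *ₚ s))) ∎

  *ₚ-distribʳ : _*ₚ_ DistributesOverʳ _+ₚ_
  *ₚ-distribʳ p r s = begin
    (r +ₚ s) *ₚ p       ≈⟨ *ₚ-comm (r +ₚ s) p ⟩
    p *ₚ (r +ₚ s)       ≈⟨ *ₚ-distribˡ p r s ⟩
    p *ₚ r +ₚ p *ₚ s    ≈⟨ +ₚ-cong (*ₚ-comm p r) (*ₚ-comm p s) ⟩
    r *ₚ p +ₚ s *ₚ p    ∎

  ·ₚ-*ₚ : ∀ a p r → (a ·ₚ p) *ₚ r ≋ a ·ₚ (p *ₚ r)
  ·ₚ-*ₚ a []      r = ≋-refl
  ·ₚ-*ₚ a (b ∷ p) r = begin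
    (a * b) ·ₚ r +ₚ (0# ∷ ((a ·ₚ p) *ₚ r))     ≈⟨ +ₚ-cong (*-·ₚ a b r) (∷-cong (sym (zeroʳ a)) (·ₚ-*ₚ a p r)) ⟩
    a ·ₚ (b ·ₚ r) +ₚ a ·ₚ (0# ∷ (p *ₚ r))      ≈⟨ ·ₚ-distrib-+ₚ a (b ·ₚ r) _ ⟨
    a ·ₚ (b ·ₚ r +ₚ (0# ∷ (p *ₚ r)))           ∎

  *ₚ-assoc : Associative _*ₚ_
  *ₚ-assoc []      r s = ≋-refl
  *ₚ-assoc (a ∷ p) r s = begin
    (a ·ₚ r +ₚ (0# ∷ (p *ₚ r))) *ₚ s           ≈⟨ *ₚ-distribʳ s (a ·ₚ r) _ ⟩
    (a ·ₚ r) *ₚ s +ₚ (0# ·ₚ s +ₚ (0# ∷ ((p *ₚ r) *ₚ s)))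
      ≈⟨ +ₚ-cong (·ₚ-*ₚ a r s) (+ₚ-cong (0#·ₚ s) (∷-cong refl (*ₚ-assoc p r s))) ⟩
    a ·ₚ (r *ₚ s) +ₚ (0# ∷ (p *ₚ (r *ₚ s)))    ∎

  *ₚ-identityˡ : LeftIdentity 1ₚ _*ₚ_
  *ₚ-identityˡ p = ≋-trans (+ₚ-cong (1#·ₚ p) 0∷[]≋[]) (+ₚ-identityʳ p)

  *ₚ-identityʳ : RightIdentity 1ₚ _*ₚ_
  *ₚ-identityʳ p = ≋-trans (*ₚ-comm p 1ₚ) (*ₚ-identityˡ p)

  Pol-isCommutativeRing : IsCommutativeRing _≈ₚ_ _+ₚ_ _*ₚ_ (-ₚ_) [] 1ₚ
  Pol-isCommutativeRing = record
    { isRing = record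
      { +-isAbelianGroup = record
        { isGroup = record
          { isMonoid = record
            { isSemigroup = record
              { isMagma = record
                { isEquivalence = record
                  { refl = λ i → refl ; sym = λ e i → sym (e i) ; trans = λ e f i → trans (e i) (f i) }
                ; ∙-cong = λ {p} {p′} {r} {r′} e f → ≋⇒≈ₚ (+ₚ-cong {p} {p′} {r} {r′} (≈ₚ⇒≋ e) (≈ₚ⇒≋ f))
                }
              ; assoc = λ p r s → ≋⇒≈ₚ (+ₚ-assoc p r s)
              }
            ; identity = (λ p i → refl) , λ p → ≋⇒≈ₚ (+ₚ-identityʳ p)
            }
          ; inverse = (λ p → ≋⇒≈ₚ (-ₚ-inverseˡ p)) , λ p → ≋⇒≈ₚ (-ₚ-inverseʳ p)
          ; ⁻¹-cong = λ {p} {p′} e → ≋⇒≈ₚ (-ₚ-cong {p} {p′} (≈ₚ⇒≋ e))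
          }
        ; comm = λ p r → ≋⇒≈ₚ (+ₚ-comm p r)
        }
      ; *-cong = λ {p} {p′} {r} {r′} e f → ≋⇒≈ₚ (*ₚ-cong {p} {p′} {r} {r′} (≈ₚ⇒≋ e) (≈ₚ⇒≋ f))
      ; *-assoc = λ p r s → ≋⇒≈ₚ (*ₚ-assoc p r s)
      ; *-identity = (λ p → ≋⇒≈ₚ (*ₚ-identityˡ p)) , λ p → ≋⇒≈ₚ (*ₚ-identityʳ p)
      ; distrib = (λ p r s → ≋⇒≈ₚ (*ₚ-distribˡ p r s)) , λ p r s → ≋⇒≈ₚ (*ₚ-distribʳ p r s)
      }
    ; *-comm = λ p r → ≋⇒≈ₚ (*ₚ-comm p r)
    }

  Pol-commutativeRing : CommutativeRing c ℓ
  Pol-commutativeRing = record { isCommutativeRing = Pol-isCommutativeRing }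

module _ {c ℓ} (S : CommutativeRing c ℓ) where

  open CommutativeRing S

  module Splitting (w b : ℕ → Carrier) (b-one : b 1 ≈ 1#)
    (b-+ : ∀ m n → b (m ℕ.+ n) ≈ b m + w m * b n)
    where

    open import Algebra.Properties.CommutativeSemigroup +-commutativeSemigroup
      using (interchange; xy∙z≈xz∙y)
    open import Algebra.Properties.CommutativeSemigroup *-commutativeSemigroup
      using () renaming (xy∙z≈xz∙y to xy*z≈xz*y)
    open import Algebra.Properties.Group +-group
      using (//-rightDividesˡ; //-rightDividesʳ; x≈y⇒x∙y⁻¹≈ε; quasigroup)
    open import Algebra.Properties.Quasigroup quasigroup using (x≈z//y)
    open import Algebra.Properties.Ring ring using ([y-z]x≈yx-zx)
    open import Relation.Binary.Reasoning.Setoid setoid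

    private
      1≤1 : 1 ≤ 1
      1≤1 = s≤s z≤n

    Splits : (u v : ℕ → Carrier) → Set ℓ
    Splits u v = ∀ m n → 1 ≤ m → 1 ≤ n → b (m ℕ.+ n) ≈ u n * b m + v m * b n

    ShapeU ShapeV : Carrier → (ℕ → Carrier) → Set ℓ
    ShapeU z u = ∀ n → 1 ≤ n → u n ≈ 1# + z * b n
    ShapeV z v = ∀ m → 1 ≤ m → v m ≈ w m - z * b m

    x*b₁≈x : ∀ x → x * b 1 ≈ x
    x*b₁≈x x = trans (*-congˡ b-one) (*-identityʳ x)

    module _ {u v : ℕ → Carrier} (splits : Splits u v) where

      splits-1-n : ∀ n → 1 ≤ n → u n + v 1 * b n ≈ 1# + w 1 * b n
      splits-1-n n 1≤n = begin
        u n + v 1 * b n         ≈⟨ +-congʳ (x*b₁≈x (u n)) ⟨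
        u n * b 1 + v 1 * b n   ≈⟨ splits 1 n 1≤1 1≤n ⟨
        b (1 ℕ.+ n)             ≈⟨ b-+ 1 n ⟩
        b 1 + w 1 * b n         ≈⟨ +-congʳ b-one ⟩
        1# + w 1 * b n          ∎

      splits-m-1 : ∀ m → 1 ≤ m → v m + u 1 * b m ≈ w m + b m
      splits-m-1 m 1≤m = begin
        v m + u 1 * b m         ≈⟨ +-comm (v m) _ ⟩
        u 1 * b m + v m         ≈⟨ +-congˡ (x*b₁≈x (v m)) ⟨
        u 1 * b m + v m * b 1   ≈⟨ splits m 1 1≤m 1≤1 ⟨
        b (m ℕ.+ 1)             ≈⟨ b-+ m 1 ⟩
        b m + w m * b 1         ≈⟨ +-congˡ (x*b₁≈x (w m)) ⟩
        b m + w m               ≈⟨ +-comm (b m) (w m) ⟩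
        w m + b m               ∎

      u₁-1≈w₁-v₁ : u 1 - 1# ≈ w 1 - v 1
      u₁-1≈w₁-v₁ = x≈z//y (u 1 - 1#) (v 1) (w 1) (begin
        (u 1 - 1#) + v 1        ≈⟨ xy∙z≈xz∙y (u 1) (- 1#) (v 1) ⟩
        (u 1 + v 1) - 1#        ≈⟨ +-congʳ (+-congˡ (x*b₁≈x (v 1))) ⟨
        (u 1 + v 1 * b 1) - 1#  ≈⟨ +-congʳ (splits-1-n 1 1≤1) ⟩
        (1# + w 1 * b 1) - 1#   ≈⟨ +-congʳ (+-comm 1# _) ⟩
        (w 1 * b 1 + 1#) - 1#   ≈⟨ //-rightDividesʳ 1# _ ⟩
        w 1 * b 1               ≈⟨ x*b₁≈x (w 1) ⟩
        w 1                     ∎)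

      splits⇒shapeU : ShapeU (u 1 - 1#) u
      splits⇒shapeU n 1≤n = begin
        u n                             ≈⟨ x≈z//y (u n) (v 1 * b n) _ (splits-1-n n 1≤n) ⟩
        (1# + w 1 * b n) - v 1 * b n    ≈⟨ +-assoc 1# _ _ ⟩
        1# + (w 1 * b n - v 1 * b n)    ≈⟨ +-congˡ ([y-z]x≈yx-zx (b n) (w 1) (v 1)) ⟨
        1# + (w 1 - v 1) * b n          ≈⟨ +-congˡ (*-congʳ u₁-1≈w₁-v₁) ⟨
        1# + (u 1 - 1#) * b n           ∎

      splits⇒shapeV : ShapeV (u 1 - 1#) v
      splits⇒shapeV m 1≤m = x≈z//y (v m) ((u 1 - 1#) * b m) (w m) (begin
        v m + (u 1 - 1#) * b m          ≈⟨ +-congˡ ([y-z]x≈yx-zx (b m) (u 1) 1#) ⟩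
        v m + (u 1 * b m - 1# * b m)    ≈⟨ +-congˡ (+-congˡ (-‿cong (*-identityˡ (b m)))) ⟩
        v m + (u 1 * b m - b m)         ≈⟨ +-assoc (v m) _ _ ⟨
        (v m + u 1 * b m) - b m         ≈⟨ +-congʳ (splits-m-1 m 1≤m) ⟩
        (w m + b m) - b m               ≈⟨ //-rightDividesʳ (b m) (w m) ⟩
        w m                             ∎)

    shapes⇒splits : ∀ {u v} z → ShapeU z u → ShapeV z v → Splits u v
    shapes⇒splits {u} {v} z shapeU shapeV m n 1≤m 1≤n = sym (begin
      u n * b m + v m * b n
        ≈⟨ +-cong (*-congʳ (shapeU n 1≤n)) (*-congʳ (shapeV m 1≤m)) ⟩
      (1# + z * b n) * b m + (w m - z * b m) * b n
        ≈⟨ +-cong (distribʳ (b m) 1# _) ([y-z]x≈yx-zx (b n) (w m) _) ⟩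
      (1# * b m + z * b n * b m) + (w m * b n - z * b m * b n)
        ≈⟨ interchange _ _ _ _ ⟩
      (1# * b m + w m * b n) + (z * b n * b m - z * b m * b n)
        ≈⟨ +-cong (+-congʳ (*-identityˡ (b m))) (x≈y⇒x∙y⁻¹≈ε (xy*z≈xz*y z (b n) (b m))) ⟩
      (b m + w m * b n) + 0#
        ≈⟨ +-identityʳ _ ⟩
      b m + w m * b n
        ≈⟨ b-+ m n ⟨
      b (m ℕ.+ n) ∎)

    shapeU⇒z≈u₁-1 : ∀ {u} z → ShapeU z u → z ≈ u 1 - 1#
    shapeU⇒z≈u₁-1 {u} z shapeU = x≈z//y z 1# (u 1) (begin
      z + 1#         ≈⟨ +-comm z 1# ⟩
      1# + z         ≈⟨ +-congˡ (x*b₁≈x z) ⟨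
      1# + z * b 1   ≈⟨ shapeU 1 1≤1 ⟨
      u 1            ∎)

    shapeV⇒z≈w₁-v₁ : ∀ {v} z → ShapeV z v → z ≈ w 1 - v 1
    shapeV⇒z≈w₁-v₁ {v} z shapeV = x≈z//y z (v 1) (w 1) (begin
      z + v 1               ≈⟨ +-comm z (v 1) ⟩
      v 1 + z               ≈⟨ +-congʳ (shapeV 1 1≤1) ⟩
      (w 1 - z * b 1) + z   ≈⟨ +-congʳ (+-congˡ (-‿cong (x*b₁≈x z))) ⟩
      (w 1 - z) + z         ≈⟨ //-rightDividesˡ z (w 1) ⟩
      w 1                   ∎)

  -- Powers and quantum integers enter only through their recursions, so that
  -- _^ₚ_ and [_]q can be plugged in with every hypothesis holding by refl.
  module QuantumIntegers (q : Carrier) (q^_ [_] : ℕ → Carrier)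
    (q^-zero : q^ 0 ≈ 1#) (q^-suc : ∀ n → q^ suc n ≈ q * q^ n)
    ([]-zero : [ 0 ] ≈ 0#) ([]-suc : ∀ n → [ suc n ] ≈ [ n ] + q^ n)
    where

    open import Relation.Binary.Reasoning.Setoid setoid

    q^-+ : ∀ m n → q^ (m ℕ.+ n) ≈ q^ m * q^ n
    q^-+ zero    n = sym (trans (*-congʳ q^-zero) (*-identityˡ (q^ n)))
    q^-+ (suc m) n = begin
      q^ suc (m ℕ.+ n)   ≈⟨ q^-suc (m ℕ.+ n) ⟩
      q * q^ (m ℕ.+ n)   ≈⟨ *-congˡ (q^-+ m n) ⟩
      q * (q^ m * q^ n)  ≈⟨ *-assoc q _ _ ⟨
      (q * q^ m) * q^ n  ≈⟨ *-congʳ (q^-suc m) ⟨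
      q^ suc m * q^ n    ∎

    []-+ : ∀ m n → [ m ℕ.+ n ] ≈ [ m ] + q^ m * [ n ]
    []-+ m zero = begin
      [ m ℕ.+ 0 ]           ≡⟨ cong [_] (ℕₚ.+-identityʳ m) ⟩
      [ m ]                 ≈⟨ +-identityʳ [ m ] ⟨
      [ m ] + 0#            ≈⟨ +-congˡ (zeroʳ (q^ m)) ⟨
      [ m ] + q^ m * 0#     ≈⟨ +-congˡ (*-congˡ []-zero) ⟨
      [ m ] + q^ m * [ 0 ]  ∎
    []-+ m (suc n) = begin
      [ m ℕ.+ suc n ]                       ≡⟨ cong [_] (ℕₚ.+-suc m n) ⟩
      [ suc (m ℕ.+ n) ]                     ≈⟨ []-suc (m ℕ.+ n) ⟩
      [ m ℕ.+ n ] + q^ (m ℕ.+ n)            ≈⟨ +-cong ([]-+ m n) (q^-+ m n) ⟩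
      ([ m ] + q^ m * [ n ]) + q^ m * q^ n  ≈⟨ +-assoc [ m ] _ _ ⟩
      [ m ] + (q^ m * [ n ] + q^ m * q^ n)  ≈⟨ +-congˡ (distribˡ (q^ m) _ _) ⟨
      [ m ] + q^ m * ([ n ] + q^ n)         ≈⟨ +-congˡ (*-congˡ ([]-suc n)) ⟨
      [ m ] + q^ m * [ suc n ]              ∎

    [1]≈1 : [ 1 ] ≈ 1#
    [1]≈1 = trans ([]-suc 0) (trans (+-cong []-zero q^-zero) (+-identityˡ 1#))

    q^1≈q : q^ 1 ≈ q
    q^1≈q = trans (q^-suc 0) (trans (*-congˡ q^-zero) (*-identityʳ q))

    open Splitting q^_ [_] [1]≈1 []-+

    characterisation : ∀ u v →
      (Splits u v ⇔ ∃ λ z → ShapeU z u × ShapeV z v)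
      × (∀ z → ShapeU z u → ShapeV z v → (z ≈ u 1 - 1#) × (z ≈ q - v 1))
    characterisation u v =
      mk⇔ (λ splits → u 1 - 1# , splits⇒shapeU splits , splits⇒shapeV splits)
          (λ (z , shapeU , shapeV) → shapes⇒splits z shapeU shapeV)
      , λ z shapeU shapeV →
          shapeU⇒z≈u₁-1 z shapeU , trans (shapeV⇒z≈w₁-v₁ z shapeV) (+-congʳ q^1≈q)

open import Data.Nat using (_+_)

theorem3 : ∀ {c ℓ} (R : CommutativeRing c ℓ) → let open Poly R in
    (u v : ℕ → Pol) →
      ((∀ m n → 1 ≤ m → 1 ≤ n → [ m + n ]q ≈ₚ u n *ₚ [ m ]q +ₚ v m *ₚ [ n ]q)
        ⇔ ∃ λ z → (∀ n → 1 ≤ n → u n ≈ₚ 1ₚ +ₚ z *ₚ [ n ]q)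
                × (∀ m → 1 ≤ m → v m ≈ₚ qₚ ^ₚ m -ₚ z *ₚ [ m ]q))
      × (∀ z → (∀ n → 1 ≤ n → u n ≈ₚ 1ₚ +ₚ z *ₚ [ n ]q)
             → (∀ m → 1 ≤ m → v m ≈ₚ qₚ ^ₚ m -ₚ z *ₚ [ m ]q)
             → (z ≈ₚ u 1 -ₚ 1ₚ) × (z ≈ₚ qₚ -ₚ v 1))
theorem3 R = characterisation
  where
  open Poly R
  open CommutativeRing R using (refl)
  open QuantumIntegers (PolynomialRing.Pol-commutativeRing R) qₚ (qₚ ^ₚ_) [_]q
    (λ _ → refl) (λ _ _ → refl) (λ _ → refl) (λ _ _ → refl)
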